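{- Let $n\ge 2$ be even, let $p_1,\dots,p_l$ be distinct primes each of which is a $\varphi$-divisor of $n$ of degree $k_i$ (with $p_i^{k_i}\ge 3$), let $2\le m\le\min(p_1^{k_1}-1,\dots,p_l^{k_l}-1)$, let $c=p_1^{n_1}\cdots p_l^{n_l}$ with natural $n_1,\dots,n_l$, and let $b$ be a nonnegative integer. Let $p$ be a prime and $k\in\mathbb{N}$. Then the equation $\sum_{i=1}^m x_i^n=bc^n$ has no solution in nonnegative integers in each of the following cases: 1) $m<2^n-1$ and $b\in[m+1,\,2^n-1]$; 2) $\varphi(p^k)\mid n$, $p^k\ge 3$, $m<p^k-1$ and $r_{b;p^k}>m$; 3) $2^k\mid n$ with $k\ge 2$, $m<2^{k+2}-1$ and $r_{b;2^{k+2}}>m$; 4) $\frac{\varphi(p^k)}{2}\mid n$, $p\ge 3$, $m<\frac{p^k-1}{2}$ and $r_{b;p^k}\in[m+1,\,p^k-m-1]$.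
   Context: $\varphi$ is Euler's totient function. For an even natural number $n$, a prime $q$ is a $\varphi$-divisor of $n$ if there is a natural $k$ with $q^k\ge3$ and $\varphi(q^k)\mid n$; the largest such $k$ is its degree. $r_{b;c}$ denotes the remainder of the division of the nonnegative integer $b$ by the natural number $c$. -}

module Defs where

open import Data.Nat using (ℕ; zero; suc; _+_; _*_; _∸_; _^_; _≤_; _<_; _≥_; _%_)
open import Data.Nat.Properties using (_≟_)
open import Data.Nat.GCD using (gcd)
open import Data.Nat.Divisibility using (_∣_)
open import Data.Nat.Primality using (Prime)
open import Data.List using (length; filter; upTo)
open import Data.Fin using (Fin; zero; suc)
open import Data.Product using (_×_)

φ : ℕ → ℕ
φ n = length (filter (λ a → gcd (suc a) n ≟ 1) (upTo n))

IsφDivisorOfDegree : ℕ → ℕ → ℕ → Set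
IsφDivisorOfDegree n q k =
  Prime q × (q ^ k ≥ 3) × (φ (q ^ k) ∣ n) ×
  (∀ j → q ^ j ≥ 3 → φ (q ^ j) ∣ n → j ≤ k)

-- remainder r_{b;c} of b divided by c (c is natural, i.e. ≥ 1; the
-- c = 0 clause is never used)
rem : ℕ → ℕ → ℕ
rem b zero = b
rem b (suc c) = b % suc c

sumFin : ∀ m → (Fin m → ℕ) → ℕ
sumFin zero f = 0
sumFin (suc m) f = f zero + sumFin m (λ i → f (suc i))

prodFin : ∀ m → (Fin m → ℕ) → ℕ
prodFin zero f = 1
prodFin (suc m) f = f zero * prodFin m (λ i → f (suc i))

module Submission where

open import Defs
open import Data.Fin using (Fin; zero; suc)
open import Data.List using ([]; _∷_; [_]; _++_; length; filter; upTo)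
open import Data.List.Properties using (applyUpTo-∷ʳ; length-++; filter-++; filter-accept; filter-reject)
open import Data.Nat
open import Data.Nat.Combinatorics using (_C_; nC1≡n; nCn≡1; k>n⇒nCk≡0; nCk+nC[k+1]≡[n+1]C[k+1])
open import Data.Nat.Coprimality as Coprime using (Coprime; prime⇒coprime; coprime-divisor; coprime⇒gcd≡1)
open import Data.Nat.DivMod
open import Data.Nat.Divisibility
open import Data.Nat.GCD using (gcd; gcd-greatest)
open import Data.Nat.Primality using (Prime; euclidsLemma; prime⇒irreducible; prime⇒nonZero; prime⇒nonTrivial)
open import Data.Nat.Properties
open import Algebra.Properties.CommutativeSemigroup +-commutativeSemigroup
  using () renaming (interchange to +-interchange; xy∙z≈xz∙y to +-xy∙z≈xz∙y)
open import Algebra.Properties.CommutativeSemigroup *-commutativeSemigroup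
  using () renaming (interchange to *-interchange; x∙yz≈y∙xz to *-x∙yz≈y∙xz)
open import Data.Nat.Tactic.RingSolver using (solve; solve-∀)
open import Data.Product using (∃; _,_; _×_; proj₁; proj₂)
open import Data.Sum using (_⊎_; inj₁; inj₂; [_,_]′; map₁)
open import Function using (_∘_; id)
open import Function.Definitions using (Injective)
open import Relation.Nullary using (Dec; yes; no; contradiction)
open import Relation.Unary using (Decidable)
open import Relation.Binary.PropositionalEquality hiding ([_])

-- Work modulo a prime power N = q^K. When φ(q^K) ∣ n, Euler's theorem makes every n-th
-- power ≡ 0 or 1 (mod N), and ≡ 0 exactly on multiples of q; the same holds for q = 2,
-- N = 2^(k+2) when 2^k ∣ n, because odd squares are ≡ 1 (mod 8) and lifting squares
-- gains a factor 2 each time. So a sum of m < N such powers has residue in [0, m],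
-- which rules out cases 2 and 3. If only φ(p^k)/2 ∣ n with p odd, every n-th power
-- prime to p squares to 1, hence is ≡ ±1 (the only square roots of 1 modulo an odd
-- prime power), confining the residue of the sum to [0, m] ∪ [N − m, N) and ruling
-- out case 4. Case 1 holds because every x_i ≤ 1.
-- Finally a φ-divisor q of n can be cancelled from c: if q^n divides the right-hand
-- side then the residues force q ∣ x_i for all i, and dividing by q^n gives a smaller
-- solution. So no solution for b yields none for b c^n.

n<m^n : ∀ {m} → 1 < m → ∀ n → n < m ^ n
n<m^n _ zero = z<s
n<m^n {m} 1<m (suc n) = begin-strict
  suc n              <⟨ s≤s (n<m^n 1<m n) ⟩
  suc (m ^ n)        ≤⟨ +-monoˡ-≤ (m ^ n) (≤-trans (s≤s z≤n) (n<m^n 1<m n)) ⟩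
  m ^ n + m ^ n      ≡⟨ cong (m ^ n +_) (+-identityʳ (m ^ n)) ⟨
  2 * m ^ n          ≤⟨ *-monoˡ-≤ (m ^ n) 1<m ⟩
  m * m ^ n          ∎
  where open ≤-Reasoning

4+i≤2^[2+i] : ∀ i → 4 + i ≤ 2 ^ (2 + i)
4+i≤2^[2+i] zero = ≤-refl
4+i≤2^[2+i] (suc i) = begin
  1 + (4 + i)                      ≤⟨ +-mono-≤ (≤-trans (s≤s z≤n) IH) IH ⟩
  2 ^ (2 + i) + 2 ^ (2 + i)        ≡⟨ cong (2 ^ (2 + i) +_) (+-identityʳ _) ⟨
  2 ^ (3 + i)                      ∎
  where
  open ≤-Reasoning
  IH : 4 + i ≤ 2 ^ (2 + i)
  IH = 4+i≤2^[2+i] i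

^-monoʳ-∣ : ∀ m {j k} → j ≤ k → m ^ j ∣ m ^ k
^-monoʳ-∣ m {j} {k} j≤k = divides (m ^ (k ∸ j)) (begin
  m ^ k                 ≡⟨ cong (m ^_) (m+[n∸m]≡n j≤k) ⟨
  m ^ (j + (k ∸ j))     ≡⟨ ^-distribˡ-+-* m j (k ∸ j) ⟩
  m ^ j * m ^ (k ∸ j)   ≡⟨ *-comm (m ^ j) _ ⟩
  m ^ (k ∸ j) * m ^ j   ∎)
  where open ≡-Reasoning

^-monoˡ-∣ : ∀ {m n} k → m ∣ n → m ^ k ∣ n ^ k
^-monoˡ-∣ zero _ = ∣-refl
^-monoˡ-∣ (suc k) m∣n = *-pres-∣ m∣n (^-monoˡ-∣ k m∣n)

^-distribʳ-* : ∀ m n k → (m * n) ^ k ≡ m ^ k * n ^ k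
^-distribʳ-* m n zero = refl
^-distribʳ-* m n (suc k) = trans (cong (m * n *_) (^-distribʳ-* m n k)) (*-interchange m n (m ^ k) (n ^ k))

prime^suc>1 : ∀ {q} → Prime q → ∀ j → 1 < q ^ suc j
prime^suc>1 {q} q-prime j = ^-monoʳ-< q (nonTrivial⇒n>1 q {{prime⇒nonTrivial q-prime}}) (z<s {j})

∤2⇒odd : ∀ {x} → 2 ∤ x → ∃ λ h → x ≡ 1 + 2 * h
∤2⇒odd {zero} 2∤x = contradiction (2 ∣0) 2∤x
∤2⇒odd {suc zero} _ = 0 , refl
∤2⇒odd {suc (suc x)} 2∤x with ∤2⇒odd {x} (2∤x ∘ ∣m∣n⇒∣m+n ∣-refl)
... | h , refl = suc h , solve (h ∷ [])

oddPrime-2∤ : ∀ {p} → Prime p → 2 < p → 2 ∤ p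
oddPrime-2∤ p-prime 2<p 2∣p with prime⇒irreducible p-prime 2∣p
... | inj₂ refl = <-irrefl refl 2<p

≤pred⇒< : ∀ {m N} .{{_ : NonZero N}} → m ≤ N ∸ 1 → m < N
≤pred⇒< {N = suc _} m≤N∸1 = s≤s m≤N∸1

+<⇐≤∸∸1 : ∀ {r m N} → 0 < r → r ≤ N ∸ m ∸ 1 → r + m < N
+<⇐≤∸∸1 {r} {m} {N} 0<r r≤N∸m∸1 = begin-strict
  r + m        <⟨ +-monoˡ-< m (≤pred⇒< {{>-nonZero 0<N∸m}} r≤N∸m∸1) ⟩
  N ∸ m + m    ≡⟨ m∸n+n≡m (<⇒≤ (m∸n≢0⇒n<m {N} {m} (≢-nonZero⁻¹ _ {{>-nonZero 0<N∸m}}))) ⟩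
  N            ∎
  where
  open ≤-Reasoning
  0<N∸m : 0 < N ∸ m
  0<N∸m = <-≤-trans 0<r (≤-trans r≤N∸m∸1 (m∸n≤m (N ∸ m) 1))

rem≡% : ∀ b N .{{_ : NonZero N}} → rem b N ≡ b % N
rem≡% b (suc N) = refl

%≡-1⇒[1+]%≡0 : ∀ {N v} .{{_ : NonZero N}} → v % N ≡ N ∸ 1 → (v + 1) % N ≡ 0
%≡-1⇒[1+]%≡0 {N} {v} v%N≡N∸1 = begin
  (v + 1) % N                  ≡⟨ cong (λ z → (z + 1) % N) (m≡m%n+[m/n]*n v N) ⟩
  (v % N + v / N * N + 1) % N  ≡⟨ cong (_% N) (+-xy∙z≈xz∙y (v % N) (v / N * N) 1) ⟩
  (v % N + 1 + v / N * N) % N  ≡⟨ [m+kn]%n≡m%n (v % N + 1) (v / N) N ⟩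
  (v % N + 1) % N              ≡⟨ cong (λ z → (z + 1) % N) v%N≡N∸1 ⟩
  (N ∸ 1 + 1) % N              ≡⟨ cong (_% N) (m∸n+n≡m (>-nonZero⁻¹ N)) ⟩
  N % N                        ≡⟨ n%n≡0 N ⟩
  0                            ∎
  where open ≡-Reasoning

sumFin-cong : ∀ m {f g : Fin m → ℕ} → (∀ i → f i ≡ g i) → sumFin m f ≡ sumFin m g
sumFin-cong zero _ = refl
sumFin-cong (suc m) f≗g = cong₂ _+_ (f≗g zero) (sumFin-cong m (f≗g ∘ suc))

sumFin-+ : ∀ m (f g : Fin m → ℕ) → sumFin m (λ i → f i + g i) ≡ sumFin m f + sumFin m g
sumFin-+ zero _ _ = refl
sumFin-+ (suc m) f g = begin
  f zero + g zero + sumFin m (λ i → f (suc i) + g (suc i))  ≡⟨ cong (f zero + g zero +_) (sumFin-+ m _ _) ⟩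
  f zero + g zero + (F + G)                                 ≡⟨ +-interchange (f zero) (g zero) F G ⟩
  f zero + F + (g zero + G)                                 ∎
  where
  open ≡-Reasoning
  F : ℕ
  F = sumFin m (f ∘ suc)
  G : ℕ
  G = sumFin m (g ∘ suc)

sumFin-*ˡ : ∀ m c (f : Fin m → ℕ) → sumFin m (λ i → c * f i) ≡ c * sumFin m f
sumFin-*ˡ zero c _ = sym (*-zeroʳ c)
sumFin-*ˡ (suc m) c f = trans (cong (c * f zero +_) (sumFin-*ˡ m c (f ∘ suc))) (sym (*-distribˡ-+ c (f zero) _))

sumFin-≤ : ∀ m {c} (f : Fin m → ℕ) → (∀ i → f i ≤ c) → sumFin m f ≤ m * c
sumFin-≤ zero _ _ = z≤n
sumFin-≤ (suc m) f f≤c = +-mono-≤ (f≤c zero) (sumFin-≤ m (f ∘ suc) (f≤c ∘ suc))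

≤-sumFin : ∀ m (f : Fin m → ℕ) i → f i ≤ sumFin m f
≤-sumFin (suc m) f zero = m≤m+n (f zero) _
≤-sumFin (suc m) f (suc i) = ≤-trans (≤-sumFin m (f ∘ suc) i) (m≤n+m _ (f zero))

sumFin≡0⇒≡0 : ∀ m (f : Fin m → ℕ) → sumFin m f ≡ 0 → ∀ i → f i ≡ 0
sumFin≡0⇒≡0 (suc m) f f≡0 zero = m+n≡0⇒m≡0 (f zero) f≡0
sumFin≡0⇒≡0 (suc m) f f≡0 (suc i) = sumFin≡0⇒≡0 m (f ∘ suc) (m+n≡0⇒n≡0 (f zero) f≡0) i

sumFin-% : ∀ {N} .{{_ : NonZero N}} m (f : Fin m → ℕ) → sumFin m f % N ≡ sumFin m (λ i → f i % N) % N
sumFin-% zero _ = refl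
sumFin-% {N} (suc m) f = begin
  (f zero + F) % N                    ≡⟨ %-distribˡ-+ (f zero) F N ⟩
  (f zero % N + F % N) % N            ≡⟨ cong (λ z → (f zero % N + z) % N) (sumFin-% m (f ∘ suc)) ⟩
  (f zero % N + F′ % N) % N           ≡⟨ cong (λ z → (z + F′ % N) % N) (m%n%n≡m%n (f zero) N) ⟨
  (f zero % N % N + F′ % N) % N       ≡⟨ %-distribˡ-+ (f zero % N) F′ N ⟨
  (f zero % N + F′) % N               ∎
  where
  open ≡-Reasoning
  F : ℕ
  F = sumFin m (f ∘ suc)
  F′ : ℕ
  F′ = sumFin m (λ i → f (suc i) % N)

infix 4 _≡1[mod_]

_≡1[mod_] : ℕ → ℕ → Set
y ≡1[mod N ] = ∃ λ t → y ≡ 1 + N * t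

≡1⇒%≡1 : ∀ {y N} .{{_ : NonZero N}} → 1 < N → y ≡1[mod N ] → y % N ≡ 1
≡1⇒%≡1 {N = N} 1<N (t , refl) = begin
  (1 + N * t) % N ≡⟨ cong (λ z → (1 + z) % N) (*-comm N t) ⟩
  (1 + t * N) % N ≡⟨ [m+kn]%n≡m%n 1 t N ⟩
  1 % N           ≡⟨ m<n⇒m%n≡m 1<N ⟩
  1               ∎
  where open ≡-Reasoning

[1+a]^n-expansion : ∀ a n → ∃ λ h → (1 + a) ^ n ≡ 1 + n * a + a * a * h
[1+a]^n-expansion a zero = 0 , solve (a ∷ [])
[1+a]^n-expansion a (suc n) with [1+a]^n-expansion a n
... | h , eq = h + n + a * h , (begin
  (1 + a) * (1 + a) ^ n              ≡⟨ cong ((1 + a) *_) eq ⟩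
  (1 + a) * (1 + n * a + a * a * h)  ≡⟨ solve (a ∷ n ∷ h ∷ []) ⟩
  1 + suc n * a + a * a * (h + n + a * h) ∎)
  where open ≡-Reasoning

≡1-^ : ∀ {y N} s → y ≡1[mod N ] → y ^ s ≡1[mod N ]
≡1-^ {N = N} s (t , refl) with [1+a]^n-expansion (N * t) s
... | h , eq = s * t + t * (N * t) * h , trans eq (solve (N ∷ t ∷ s ∷ h ∷ []))

≡1-lift : ∀ {y q M} → q ∣ M → y ≡1[mod M ] → y ^ q ≡1[mod q * M ]
≡1-lift {q = q} {M} (divides d refl) (t , refl) with [1+a]^n-expansion (d * q * t) q
... | h , eq = t + t * t * d * h , trans eq (solve (d ∷ q ∷ t ∷ h ∷ []))

≡1-lift-^ : ∀ {y q j} i → y ≡1[mod q ^ suc j ] → y ^ (q ^ i) ≡1[mod q ^ (i + suc j) ]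
≡1-lift-^ {q = q} {j} zero y≡1 = subst (_≡1[mod q ^ suc j ]) (sym (^-identityʳ _)) y≡1
≡1-lift-^ {y} {q} {j} (suc i) y≡1 = subst (_≡1[mod q ^ (suc i + suc j) ]) y^q^i^q≡y^q^suci
  (≡1-lift (divides (q ^ (i + j)) (trans (cong (q ^_) (+-suc i j)) (*-comm q _))) (≡1-lift-^ i y≡1))
  where
  y^q^i^q≡y^q^suci : (y ^ (q ^ i)) ^ q ≡ y ^ (q ^ suc i)
  y^q^i^q≡y^q^suci = trans (^-*-assoc y (q ^ i) q) (cong (y ^_) (*-comm (q ^ i) q))

-- Fermat's little theorem

C-absorption : ∀ n k → suc k * (suc n C suc k) ≡ suc n * (n C k)
C-absorption n zero = trans (*-identityˡ _) (trans (nC1≡n (suc n)) (sym (*-identityʳ _)))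
C-absorption zero (suc k) = *-zeroʳ (2 + k)
C-absorption (suc n) (suc k) = begin
  (2 + k) * ((2 + n) C (2 + k))
    ≡⟨ cong ((2 + k) *_) (nCk+nC[k+1]≡[n+1]C[k+1] (suc n) (suc k)) ⟨
  (2 + k) * (suc n C suc k + suc n C (2 + k))
    ≡⟨ *-distribˡ-+ (2 + k) (suc n C suc k) _ ⟩
  (suc n C suc k + suc k * (suc n C suc k)) + (2 + k) * (suc n C (2 + k))
    ≡⟨ cong₂ (λ a b → (suc n C suc k + a) + b) (C-absorption n k) (C-absorption n (suc k)) ⟩
  (suc n C suc k + suc n * (n C k)) + suc n * (n C suc k)
    ≡⟨ +-assoc (suc n C suc k) _ _ ⟩
  suc n C suc k + (suc n * (n C k) + suc n * (n C suc k))
    ≡⟨ cong (suc n C suc k +_) (sym (*-distribˡ-+ (suc n) (n C k) _)) ⟩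
  suc n C suc k + suc n * (n C k + n C suc k)
    ≡⟨ cong (λ a → suc n C suc k + suc n * a) (nCk+nC[k+1]≡[n+1]C[k+1] n k) ⟩
  (2 + n) * (suc n C suc k) ∎
  where open ≡-Reasoning

p∣pCk : ∀ {q k} → Prime q → 0 < k → k < q → q ∣ q C k
p∣pCk {suc n} {suc k} q-prime _ k<q = coprime-divisor (prime⇒coprime q-prime k<q)
  (divides (n C k) (trans (C-absorption n k) (*-comm (suc n) _)))

binomialPartialSum : ℕ → ℕ → ℕ → ℕ
binomialPartialSum x n zero = 1
binomialPartialSum x n (suc k) = binomialPartialSum x n k + (n C suc k) * x ^ suc k

binomialPartialSum-suc : ∀ x n k → binomialPartialSum x (suc n) (suc k) ≡
  x * binomialPartialSum x n k + binomialPartialSum x n (suc k)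
binomialPartialSum-suc x n zero = begin
  1 + (suc n C 1) * (x * 1) ≡⟨ cong (λ c → 1 + c * (x * 1)) (nC1≡n (suc n)) ⟩
  1 + suc n * (x * 1)       ≡⟨ cong (λ c → 1 + suc c * (x * 1)) (nC1≡n n) ⟨
  1 + suc (n C 1) * (x * 1) ≡⟨ rearrange x (n C 1) ⟩
  x * 1 + (1 + (n C 1) * (x * 1)) ∎
  where
  open ≡-Reasoning
  rearrange : ∀ x c → 1 + suc c * (x * 1) ≡ x * 1 + (1 + c * (x * 1))
  rearrange = solve-∀
binomialPartialSum-suc x n (suc k) = begin
  S (suc n) (suc k) + ((suc n) C (2 + k)) * x ^ (2 + k)
    ≡⟨ cong₂ (λ a c → a + c * x ^ (2 + k)) (binomialPartialSum-suc x n k)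
             (sym (nCk+nC[k+1]≡[n+1]C[k+1] n (suc k))) ⟩
  (x * S n k + S n (suc k)) + (n C suc k + n C (2 + k)) * x ^ (2 + k)
    ≡⟨ rearrange x (S n k) (S n (suc k)) (n C suc k) (n C (2 + k)) (x ^ suc k) ⟩
  x * (S n k + (n C suc k) * x ^ suc k) + (S n (suc k) + (n C (2 + k)) * x ^ (2 + k)) ∎
  where
  open ≡-Reasoning
  S : ℕ → ℕ → ℕ
  S = binomialPartialSum x
  rearrange : ∀ x a b c d y → (x * a + b) + (c + d) * (x * y) ≡ x * (a + c * y) + (b + d * (x * y))
  rearrange = solve-∀

binomial-theorem : ∀ x n → (1 + x) ^ n ≡ binomialPartialSum x n n
binomial-theorem x zero = refl
binomial-theorem x (suc n) = begin
  (1 + x) * (1 + x) ^ n ≡⟨ cong ((1 + x) *_) (binomial-theorem x n) ⟩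
  (1 + x) * S n n       ≡⟨ rearrange x (S n n) (x ^ suc n) ⟩
  x * S n n + (S n n + 0 * x ^ suc n)
    ≡⟨ cong (λ c → x * S n n + (S n n + c * x ^ suc n)) (k>n⇒nCk≡0 (n<1+n n)) ⟨
  x * S n n + S n (suc n) ≡⟨ binomialPartialSum-suc x n n ⟨
  S (suc n) (suc n) ∎
  where
  open ≡-Reasoning
  S : ℕ → ℕ → ℕ
  S = binomialPartialSum x
  rearrange : ∀ x a y → (1 + x) * a ≡ x * a + (a + 0 * y)
  rearrange = solve-∀

binomialPartialSum≡1 : ∀ {q} → Prime q → ∀ x k → k < q → binomialPartialSum x q k ≡1[mod q ]
binomialPartialSum≡1 {q} q-prime x zero _ = 0 , sym (cong suc (*-zeroʳ q))
binomialPartialSum≡1 {q} q-prime x (suc k) k<q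
  with binomialPartialSum≡1 q-prime x k (<-trans (n<1+n k) k<q) | p∣pCk q-prime (s≤s z≤n) k<q
... | t , eq | divides c eqc = t + c * x ^ suc k , (begin
  binomialPartialSum x q k + (q C suc k) * x ^ suc k ≡⟨ cong₂ (λ a b → a + b * x ^ suc k) eq eqc ⟩
  1 + q * t + c * q * x ^ suc k                     ≡⟨ rearrange q t c (x ^ suc k) ⟩
  1 + q * (t + c * x ^ suc k) ∎)
  where
  open ≡-Reasoning
  rearrange : ∀ q t c y → 1 + q * t + c * q * y ≡ 1 + q * (t + c * y)
  rearrange = solve-∀

fermat-little : ∀ {q} → Prime q → ∀ x → ∃ λ r → x ^ q ≡ x + q * r
fermat-little {suc n} q-prime zero = 0 , sym (*-zeroʳ (suc n))
fermat-little {suc n} q-prime (suc x)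
  with fermat-little q-prime x | binomialPartialSum≡1 q-prime x n (n<1+n n)
... | r , eqr | s , eqs = s + r , (begin
  (1 + x) ^ q                                        ≡⟨ binomial-theorem x q ⟩
  binomialPartialSum x q n + (q C q) * x ^ q          ≡⟨ cong₂ (λ a c → a + c * x ^ q) eqs (nCn≡1 q) ⟩
  1 + q * s + 1 * x ^ q                              ≡⟨ cong (λ y → 1 + q * s + 1 * y) eqr ⟩
  1 + q * s + 1 * (x + q * r)                        ≡⟨ rearrange q s x r ⟩
  suc x + q * (s + r) ∎)
  where
  open ≡-Reasoning
  q : ℕ
  q = suc n
  rearrange : ∀ q s x r → 1 + q * s + 1 * (x + q * r) ≡ suc x + q * (s + r)
  rearrange = solve-∀

fermat-little-unit : ∀ {q x} → Prime q → q ∤ x → x ^ (q ∸ 1) ≡1[mod q ]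
fermat-little-unit {suc n} {zero} _ q∤x = contradiction (suc n ∣0) q∤x
fermat-little-unit {suc n} {x@(suc _)} q-prime q∤x with fermat-little q-prime x
... | r , x^q≡ = c , (begin
  x ^ n               ≡⟨ m+[n∸m]≡n (m^n>0 x n) ⟨
  1 + (x ^ n ∸ 1)     ≡⟨ cong suc x^n∸1≡c*q ⟩
  1 + c * suc n       ≡⟨ cong suc (*-comm c (suc n)) ⟩
  1 + suc n * c       ∎)
  where
  open ≡-Reasoning
  x*[x^n∸1]≡r*q : x * (x ^ n ∸ 1) ≡ r * suc n
  x*[x^n∸1]≡r*q = begin
    x * (x ^ n ∸ 1)      ≡⟨ *-distribˡ-∸ x (x ^ n) 1 ⟩
    x ^ suc n ∸ x * 1    ≡⟨ cong₂ _∸_ x^q≡ (*-identityʳ x) ⟩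
    x + suc n * r ∸ x    ≡⟨ m+n∸m≡n x _ ⟩
    suc n * r            ≡⟨ *-comm (suc n) r ⟩
    r * suc n            ∎
  q∣x^n∸1 : suc n ∣ x ^ n ∸ 1
  q∣x^n∸1 with euclidsLemma x (x ^ n ∸ 1) q-prime (divides r x*[x^n∸1]≡r*q)
  ... | inj₁ q∣x = contradiction q∣x q∤x
  ... | inj₂ q∣x^n∸1 = q∣x^n∸1
  c : ℕ
  c = quotient q∣x^n∸1
  x^n∸1≡c*q : x ^ n ∸ 1 ≡ c * suc n
  x^n∸1≡c*q = m∣n⇒n≡quotient*m q∣x^n∸1

-- Totient of prime powers

coprime-^ : ∀ {q a} → Prime q → q ∤ a → ∀ k → Coprime a (q ^ k)
coprime-^ _ _ zero (_ , i∣1) = ∣1⇒≡1 i∣1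
coprime-^ {q} {a} q-prime q∤a (suc k) {i} (i∣a , i∣q^suck) =
  coprime-^ q-prime q∤a k (i∣a , coprime-divisor i⊥q i∣q^suck)
  where
  i⊥q : Coprime i q
  i⊥q (d∣i , d∣q) with prime⇒irreducible q-prime d∣q
  ... | inj₁ d≡1 = d≡1
  ... | inj₂ refl = contradiction (∣-trans d∣i i∣a) q∤a

gcd-^≡1 : ∀ {q a} → Prime q → q ∤ a → ∀ k → gcd a (q ^ k) ≡ 1
gcd-^≡1 q-prime q∤a k = coprime⇒gcd≡1 (coprime-^ q-prime q∤a k)

gcd-^≢1 : ∀ {q a} → Prime q → q ∣ a → ∀ k → gcd a (q ^ suc k) ≢ 1
gcd-^≢1 {q} q-prime q∣a k gcd≡1 =
  nonTrivial⇒≢1 {{prime⇒nonTrivial q-prime}}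
    (∣1⇒≡1 (subst (q ∣_) gcd≡1 (gcd-greatest q∣a (m∣m*n (q ^ k)))))

-- φ M unfolds to coprimeCount M M.
coprimeCount : ℕ → ℕ → ℕ
coprimeCount M N = length (filter (λ a → gcd (suc a) M ≟ 1) (upTo N))

module _ (M N : ℕ) where
  private
    P? : Decidable (λ a → gcd (suc a) M ≡ 1)
    P? = λ a → gcd (suc a) M ≟ 1

    coprimeCount-snoc : coprimeCount M (suc N) ≡ coprimeCount M N + length (filter P? [ N ])
    coprimeCount-snoc = begin
      length (filter P? (upTo (suc N)))              ≡⟨ cong (length ∘ filter P?) (applyUpTo-∷ʳ id N) ⟨
      length (filter P? (upTo N ++ [ N ]))            ≡⟨ cong length (filter-++ P? (upTo N) [ N ]) ⟩
      length (filter P? (upTo N) ++ filter P? [ N ])  ≡⟨ length-++ (filter P? (upTo N)) ⟩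
      coprimeCount M N + length (filter P? [ N ])    ∎
      where open ≡-Reasoning

  coprimeCount-suc-coprime : gcd (suc N) M ≡ 1 → coprimeCount M (suc N) ≡ coprimeCount M N + 1
  coprimeCount-suc-coprime coprime =
    trans coprimeCount-snoc (cong (λ xs → coprimeCount M N + length xs) (filter-accept P? coprime))

  coprimeCount-suc-¬coprime : gcd (suc N) M ≢ 1 → coprimeCount M (suc N) ≡ coprimeCount M N
  coprimeCount-suc-¬coprime ¬coprime =
    trans coprimeCount-snoc (trans (cong (λ xs → coprimeCount M N + length xs) (filter-reject P? ¬coprime))
                                   (+-identityʳ _))

module _ {q : ℕ} (q-prime : Prime q) (j : ℕ) where
  private
    count : ℕ → ℕ
    count = coprimeCount (q ^ suc j)

    count-run : ∀ {N} → q ∣ N → ∀ r → r < q → count (N + r) ≡ count N + r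
    count-run {N} _ zero _ = trans (cong count (+-identityʳ N)) (sym (+-identityʳ _))
    count-run {N} q∣N (suc r) r<q = begin
      count (N + suc r)  ≡⟨ cong count (+-suc N r) ⟩
      count (suc N + r)  ≡⟨ coprimeCount-suc-coprime (q ^ suc j) (N + r) (gcd-^≡1 q-prime q∤N+r+1 (suc j)) ⟩
      count (N + r) + 1  ≡⟨ cong (_+ 1) (count-run q∣N r (<-trans (n<1+n r) r<q)) ⟩
      count N + r + 1    ≡⟨ +-assoc (count N) r 1 ⟩
      count N + (r + 1)  ≡⟨ cong (count N +_) (+-comm r 1) ⟩
      count N + suc r    ∎
      where
      open ≡-Reasoning
      q∤N+r+1 : q ∤ suc (N + r)
      q∤N+r+1 q∣N+r+1 = <⇒≱ r<q (∣⇒≤ (∣m+n∣m⇒∣n (subst (q ∣_) (sym (+-suc N r)) q∣N+r+1) q∣N))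

    count-block : ∀ {N} → q ∣ N → count (N + q) ≡ count N + (q ∸ 1)
    count-block {N} q∣N = begin
      count (N + q)        ≡⟨ cong (λ x → count (N + x)) q≡1+q′ ⟩
      count (N + suc q′)   ≡⟨ cong count (+-suc N q′) ⟩
      count (suc N + q′)   ≡⟨ coprimeCount-suc-¬coprime (q ^ suc j) (N + q′) (gcd-^≢1 q-prime q∣N+q j) ⟩
      count (N + q′)       ≡⟨ count-run q∣N q′ (subst (q′ <_) (sym q≡1+q′) (n<1+n q′)) ⟩
      count N + q′         ∎
      where
      open ≡-Reasoning
      q′ : ℕ
      q′ = q ∸ 1
      q≡1+q′ : q ≡ suc q′
      q≡1+q′ = sym (m+[n∸m]≡n (>-nonZero⁻¹ q {{prime⇒nonZero q-prime}}))
      q∣N+q : q ∣ suc (N + q′)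
      q∣N+q = subst (q ∣_) (trans (cong (N +_) q≡1+q′) (+-suc N q′)) (∣m∣n⇒∣m+n q∣N ∣-refl)

    count-multiple : ∀ M → count (M * q) ≡ M * (q ∸ 1)
    count-multiple zero = refl
    count-multiple (suc M) = begin
      count (q + M * q)          ≡⟨ cong count (+-comm q (M * q)) ⟩
      count (M * q + q)          ≡⟨ count-block (n∣m*n M) ⟩
      count (M * q) + (q ∸ 1)    ≡⟨ cong (_+ (q ∸ 1)) (count-multiple M) ⟩
      M * (q ∸ 1) + (q ∸ 1)      ≡⟨ +-comm (M * (q ∸ 1)) (q ∸ 1) ⟩
      suc M * (q ∸ 1)            ∎
      where open ≡-Reasoning

  φ-primePower : φ (q ^ suc j) ≡ q ^ j * (q ∸ 1)
  φ-primePower = trans (cong count (*-comm q (q ^ j))) (count-multiple (q ^ j))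

-- n-th powers modulo prime powers

euler-primePower : ∀ {q x} → Prime q → q ∤ x → ∀ j → x ^ φ (q ^ suc j) ≡1[mod q ^ suc j ]
euler-primePower {q} {x} q-prime q∤x j =
  subst₂ _≡1[mod_] x^[q∸1]^q^j≡x^φ (cong (q ^_) (+-comm j 1))
         (≡1-lift-^ j (subst (x ^ (q ∸ 1) ≡1[mod_]) (sym (*-identityʳ q)) (fermat-little-unit q-prime q∤x)))
  where
  x^[q∸1]^q^j≡x^φ : (x ^ (q ∸ 1)) ^ (q ^ j) ≡ x ^ φ (q ^ suc j)
  x^[q∸1]^q^j≡x^φ = begin
    (x ^ (q ∸ 1)) ^ (q ^ j)  ≡⟨ ^-*-assoc x (q ∸ 1) (q ^ j) ⟩
    x ^ ((q ∸ 1) * q ^ j)    ≡⟨ cong (x ^_) (*-comm (q ∸ 1) (q ^ j)) ⟩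
    x ^ (q ^ j * (q ∸ 1))    ≡⟨ cong (x ^_) (φ-primePower q-prime j) ⟨
    x ^ φ (q ^ suc j)        ∎
    where open ≡-Reasoning

odd-square≡1 : ∀ h → (1 + 2 * h) ^ 2 ≡1[mod 8 ]
odd-square≡1 zero = 0 , refl
odd-square≡1 (suc h) with odd-square≡1 h
... | t , eq = t + suc h , (begin
  (1 + 2 * suc h) ^ 2          ≡⟨ square-step h ⟩
  (1 + 2 * h) ^ 2 + 8 * suc h  ≡⟨ cong (_+ 8 * suc h) eq ⟩
  1 + 8 * t + 8 * suc h        ≡⟨ solve (t ∷ h ∷ []) ⟩
  1 + 8 * (t + suc h)          ∎)
  where
  open ≡-Reasoning
  square-step : ∀ h → (1 + 2 * suc h) * ((1 + 2 * suc h) * 1) ≡ (1 + 2 * h) * ((1 + 2 * h) * 1) + 8 * suc h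
  square-step = solve-∀

odd^2^≡1 : ∀ {x} → 2 ∤ x → ∀ i → x ^ (2 ^ suc i) ≡1[mod 2 ^ (i + 3) ]
odd^2^≡1 {x} 2∤x i with ∤2⇒odd 2∤x
... | h , refl = subst (_≡1[mod 2 ^ (i + 3) ]) (^-*-assoc (1 + 2 * h) 2 (2 ^ i))
                       (≡1-lift-^ i (odd-square≡1 h))

record FermatModulus (n q N : ℕ) : Set where
  field
    modulus∣ : N ∣ q ^ n
    unit^≡1 : ∀ {x} → q ∤ x → x ^ n ≡1[mod N ]

fermatModulus-^ : ∀ {n q e K} → K ≤ n → e ∣ n → (∀ {x} → q ∤ x → x ^ e ≡1[mod q ^ K ]) →
                  FermatModulus n q (q ^ K)
fermatModulus-^ {q = q} {e} {K} K≤n (divides s refl) x^e≡1 = record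
  { modulus∣ = ^-monoʳ-∣ q K≤n
  ; unit^≡1 = λ {x} q∤x → subst (_≡1[mod q ^ K ]) (trans (^-*-assoc x e s) (cong (x ^_) (*-comm e s)))
                                 (≡1-^ {N = q ^ K} s (x^e≡1 q∤x))
  }

φDivisor-fermatModulus : ∀ {n q} j → Prime q → φ (q ^ suc j) ∣ n → .{{NonZero n}} →
                         FermatModulus n q (q ^ suc j)
φDivisor-fermatModulus {n} {q} j q-prime φ∣n =
  fermatModulus-^ suc[j]≤n φ∣n (λ q∤x → euler-primePower q-prime q∤x j)
  where
  suc[j]≤n : suc j ≤ n
  suc[j]≤n = begin
    suc j              ≤⟨ n<m^n 1<q j ⟩
    q ^ j              ≤⟨ m≤m*n (q ^ j) (q ∸ 1) {{>-nonZero (m<n⇒0<n∸m 1<q)}} ⟩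
    q ^ j * (q ∸ 1)    ≡⟨ φ-primePower q-prime j ⟨
    φ (q ^ suc j)      ≤⟨ ∣⇒≤ φ∣n ⟩
    n                  ∎
    where
    open ≤-Reasoning
    1<q : 1 < q
    1<q = nonTrivial⇒n>1 q {{prime⇒nonTrivial q-prime}}

twoPower-fermatModulus : ∀ {n} i → 2 ^ (2 + i) ∣ n → .{{NonZero n}} → FermatModulus n 2 (2 ^ (4 + i))
twoPower-fermatModulus {n} i 2^[2+i]∣n = fermatModulus-^ (≤-trans (4+i≤2^[2+i] i) (∣⇒≤ 2^[2+i]∣n)) 2^[2+i]∣n
  (λ {x} 2∤x → subst (x ^ 2 ^ (2 + i) ≡1[mod_]) (cong (2 ^_) (+-comm (suc i) 3)) (odd^2^≡1 2∤x (suc i)))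

module _ {n q N : ℕ} .{{_ : NonZero N}} (fermat : FermatModulus n q N) (1<N : 1 < N) where
  open FermatModulus fermat

  fermatModulus-%≤1 : ∀ x → x ^ n % N ≤ 1
  fermatModulus-%≤1 x with q ∣? x
  ... | yes q∣x = ≤-trans (≤-reflexive (n∣m⇒m%n≡0 _ N (∣-trans modulus∣ (^-monoˡ-∣ n q∣x)))) z≤n
  ... | no q∤x = ≤-reflexive (≡1⇒%≡1 1<N (unit^≡1 q∤x))

  fermatModulus-%≡0⇒∣ : ∀ {x} → x ^ n % N ≡ 0 → q ∣ x
  fermatModulus-%≡0⇒∣ {x} x^n%N≡0 with q ∣? x
  ... | yes q∣x = q∣x
  ... | no q∤x with () ← trans (sym (≡1⇒%≡1 1<N (unit^≡1 q∤x))) x^n%N≡0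

primePower-sqrt1 : ∀ {p y} j → Prime p → 2 < p → .{{_ : NonZero (p ^ suc j)}} →
                   y * y ≡1[mod p ^ suc j ] → y % p ^ suc j ≡ 1 ⊎ y % p ^ suc j ≡ p ^ suc j ∸ 1
primePower-sqrt1 {p} {zero} j _ _ (_ , ())
primePower-sqrt1 {p} {suc w} j p-prime 2<p (t , 1+w²≡) = roots (p ∣? w) (p ∣? 2 + w)
  where
  N : ℕ
  N = p ^ suc j
  N∣[2+w]*w : N ∣ (2 + w) * w
  N∣[2+w]*w = divides t (begin
    (2 + w) * w        ≡⟨ solve (w ∷ []) ⟩
    w + w * suc w      ≡⟨ suc-injective 1+w²≡ ⟩
    N * t              ≡⟨ *-comm N t ⟩
    t * N              ∎)
    where open ≡-Reasoning
  roots : Dec (p ∣ w) → Dec (p ∣ 2 + w) → suc w % N ≡ 1 ⊎ suc w % N ≡ N ∸ 1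
  roots (yes p∣w) (yes p∣2+w) =
    contradiction (∣⇒≤ (∣m+n∣m⇒∣n (subst (p ∣_) (+-comm 2 w) p∣2+w) p∣w)) (<⇒≱ 2<p)
  roots _ (no p∤2+w) =
    inj₁ (≡1⇒%≡1 (prime^suc>1 p-prime j) (quotient N∣w , cong suc (m∣n⇒n≡m*quotient N∣w)))
    where
    N∣w : N ∣ w
    N∣w = coprime-divisor (Coprime.sym (coprime-^ p-prime p∤2+w (suc j))) N∣[2+w]*w
  roots (no p∤w) (yes _) = inj₂ (%-pred-≡0 (n∣m⇒m%n≡0 _ N N∣2+w))
    where
    N∣2+w : N ∣ 2 + w
    N∣2+w = coprime-divisor (Coprime.sym (coprime-^ p-prime p∤w (suc j)))
                            (subst (N ∣_) (*-comm (2 + w) w) N∣[2+w]*w)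

module _ {p : ℕ} (p-prime : Prime p) (2<p : 2 < p) (j : ℕ) where

  oddPrimePower-φ-even : 2 ∣ φ (p ^ suc j)
  oddPrimePower-φ-even with ∤2⇒odd (oddPrime-2∤ p-prime 2<p)
  ... | h , p≡1+2h = subst (2 ∣_) (sym (φ-primePower p-prime j))
    (∣n⇒∣m*n (p ^ j) (divides h (trans (cong (_∸ 1) p≡1+2h) (*-comm 2 h))))

  oddPrimePower-exponent : ∀ {n} .{{_ : NonZero n}} → φ (p ^ suc j) ∣ n * 2 → suc j ≤ n
  oddPrimePower-exponent {n} φ∣2n = ≤-trans (n<m^n (<-trans (n<1+n 1) 2<p) j) (*-cancelʳ-≤ (p ^ j) n 2 (begin
    p ^ j * 2          ≤⟨ *-monoʳ-≤ (p ^ j) (∸-monoˡ-≤ 1 2<p) ⟩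
    p ^ j * (p ∸ 1)    ≡⟨ φ-primePower p-prime j ⟨
    φ (p ^ suc j)      ≤⟨ ∣⇒≤ {{m*n≢0 n 2}} φ∣2n ⟩
    n * 2              ∎))
    where open ≤-Reasoning

  oddPrimePower-%≤1∨≡-1 : ∀ {n} .{{_ : NonZero n}} .{{_ : NonZero (p ^ suc j)}} → φ (p ^ suc j) / 2 ∣ n →
                          ∀ x → x ^ n % p ^ suc j ≤ 1 ⊎ x ^ n % p ^ suc j ≡ p ^ suc j ∸ 1
  oddPrimePower-%≤1∨≡-1 {n} φ/2∣n x = residue (p ∣? x)
    where
    φ∣2n : φ (p ^ suc j) ∣ n * 2
    φ∣2n = m/n∣o⇒m∣o*n oddPrimePower-φ-even φ/2∣n
    residue : Dec (p ∣ x) → x ^ n % p ^ suc j ≤ 1 ⊎ x ^ n % p ^ suc j ≡ p ^ suc j ∸ 1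
    residue (yes p∣x) = inj₁ (≤-trans (≤-reflexive (n∣m⇒m%n≡0 _ _ N∣x^n)) z≤n)
      where
      N∣x^n : p ^ suc j ∣ x ^ n
      N∣x^n = ∣-trans (^-monoʳ-∣ p (oddPrimePower-exponent φ∣2n)) (^-monoˡ-∣ n p∣x)
    residue (no p∤x) = map₁ ≤-reflexive (primePower-sqrt1 j p-prime 2<p x^n*x^n≡1)
      where
      x^n*x^n≡1 : x ^ n * x ^ n ≡1[mod p ^ suc j ]
      x^n*x^n≡1 = subst (_≡1[mod p ^ suc j ])
        (trans (sym (^-*-assoc x n 2)) (cong (x ^ n *_) (*-identityʳ (x ^ n))))
        (FermatModulus.unit^≡1 (φDivisor-fermatModulus j p-prime φ∣2n {{m*n≢0 n 2}}) p∤x)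

sumFin-%≤ : ∀ {N} .{{_ : NonZero N}} m (f : Fin m → ℕ) → (∀ i → f i % N ≤ 1) → m < N → sumFin m f % N ≤ m
sumFin-%≤ {N} m f f%N≤1 m<N = begin
  sumFin m f % N                     ≡⟨ sumFin-% m f ⟩
  sumFin m (λ i → f i % N) % N       ≡⟨ m<n⇒m%n≡m (≤-<-trans R≤m m<N) ⟩
  sumFin m (λ i → f i % N)           ≤⟨ R≤m ⟩
  m                                  ∎
  where
  open ≤-Reasoning
  R≤m : sumFin m (λ i → f i % N) ≤ m
  R≤m = ≤-trans (sumFin-≤ m _ f%N≤1) (≤-reflexive (*-identityʳ m))

residue-shift : ∀ {N v} .{{_ : NonZero N}} → v % N ≤ 1 ⊎ v % N ≡ N ∸ 1 → ∃ λ g → g + (v + g) % N ≤ 1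
residue-shift {N} {v} (inj₁ v%N≤1) = 0 , subst (λ z → z % N ≤ 1) (sym (+-identityʳ v)) v%N≤1
residue-shift (inj₂ v%N≡N∸1) = 1 , ≤-reflexive (cong suc (%≡-1⇒[1+]%≡0 v%N≡N∸1))

-- Shift every term ≡ −1 up by one. With G the number of shifts and U the number of
-- shifted terms now ≡ 1, we get G + U ≤ m and r + G ≡ U (mod N) for the residue r.
sumFin-%-near-0 : ∀ {N} .{{_ : NonZero N}} m (f : Fin m → ℕ) → (∀ i → f i % N ≤ 1 ⊎ f i % N ≡ N ∸ 1) →
                  sumFin m f % N ≤ m ⊎ N ≤ sumFin m f % N + m
sumFin-%-near-0 {N} m f residues = split (r + G <? N)
  where
  r : ℕ
  r = sumFin m f % N
  g u : Fin m → ℕ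
  g i = proj₁ (residue-shift (residues i))
  u i = (f i + g i) % N
  G : ℕ
  G = sumFin m g
  U : ℕ
  U = sumFin m u

  G+U≤m : G + U ≤ m
  G+U≤m = begin
    G + U                          ≡⟨ sumFin-+ m g u ⟨
    sumFin m (λ i → g i + u i)     ≤⟨ sumFin-≤ m _ (λ i → proj₂ (residue-shift (residues i))) ⟩
    m * 1                          ≡⟨ *-identityʳ m ⟩
    m                              ∎
    where open ≤-Reasoning

  [r+G]%N≡U%N : (r + G) % N ≡ U % N
  [r+G]%N≡U%N = begin
    (r + G) % N                    ≡⟨ %-distribˡ-+ r G N ⟩
    (r % N + G % N) % N            ≡⟨ cong (λ z → (z + G % N) % N) (m%n%n≡m%n (sumFin m f) N) ⟩
    (r + G % N) % N                ≡⟨ %-distribˡ-+ (sumFin m f) G N ⟨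
    (sumFin m f + G) % N           ≡⟨ cong (_% N) (sumFin-+ m f g) ⟨
    sumFin m (λ i → f i + g i) % N ≡⟨ sumFin-% m _ ⟩
    U % N                          ∎
    where open ≡-Reasoning

  split : Dec (r + G < N) → r ≤ m ⊎ N ≤ r + m
  split (yes r+G<N) = inj₁ (begin
    r              ≤⟨ m≤m+n r G ⟩
    r + G          ≡⟨ m<n⇒m%n≡m r+G<N ⟨
    (r + G) % N    ≡⟨ [r+G]%N≡U%N ⟩
    U % N          ≤⟨ m%n≤m U N ⟩
    U              ≤⟨ m≤n+m U G ⟩
    G + U          ≤⟨ G+U≤m ⟩
    m              ∎)
    where open ≤-Reasoning
  split (no r+G≮N) = inj₂ (≤-trans (≮⇒≥ r+G≮N) (+-monoʳ-≤ r (≤-trans (m≤m+n G U) G+U≤m)))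

NotSumOfPowers : ℕ → ℕ → ℕ → Set
NotSumOfPowers n m a = ∀ (x : Fin m → ℕ) → sumFin m (λ i → x i ^ n) ≢ a

notSumOfPowers-small : ∀ {n m b} → m < b → b < 2 ^ n → NotSumOfPowers n m b
notSumOfPowers-small {n} {m} {b} m<b b<2^n x sum≡b = <⇒≱ m<b (begin
  b                          ≡⟨ sum≡b ⟨
  sumFin m (λ i → x i ^ n)   ≤⟨ sumFin-≤ m _ x^n≤1 ⟩
  m * 1                      ≡⟨ *-identityʳ m ⟩
  m                          ∎)
  where
  open ≤-Reasoning
  x≤1 : ∀ i → x i ≤ 1
  x≤1 i with x i ≤? 1
  ... | yes x≤1 = x≤1
  ... | no x≰1 = contradiction
    (≤-trans (^-monoˡ-≤ n (≰⇒> x≰1)) (≤-trans (≤-sumFin m _ i) (≤-reflexive sum≡b))) (<⇒≱ b<2^n)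
  x^n≤1 : ∀ i → x i ^ n ≤ 1
  x^n≤1 i = ≤-trans (^-monoˡ-≤ n (x≤1 i)) (≤-reflexive (^-zeroˡ n))

notSumOfPowers-% : ∀ {n q N m b} .{{_ : NonZero N}} → FermatModulus n q N → 1 < N → m < N → m < b % N →
                   NotSumOfPowers n m b
notSumOfPowers-% {n} {m = m} fermat 1<N m<N m<b%N x sum≡b = <⇒≱ m<b%N
  (subst (λ a → a % _ ≤ m) sum≡b (sumFin-%≤ m _ (λ i → fermatModulus-%≤1 fermat 1<N (x i)) m<N))

notSumOfPowers-±1 : ∀ {n N m b} .{{_ : NonZero N}} → (∀ x → x ^ n % N ≤ 1 ⊎ x ^ n % N ≡ N ∸ 1) →
                    m < b % N → b % N + m < N → NotSumOfPowers n m b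
notSumOfPowers-±1 {n} {N} {m} residues m<b%N b%N+m<N x sum≡b
  with subst (λ a → a % N ≤ m ⊎ N ≤ a % N + m) sum≡b (sumFin-%-near-0 m _ (λ i → residues (x i)))
... | inj₁ b%N≤m = <⇒≱ m<b%N b%N≤m
... | inj₂ N≤b%N+m = <⇒≱ b%N+m<N N≤b%N+m

notSumOfPowers-φDivisor : ∀ {n m b p k} .{{_ : NonZero n}} → Prime p → φ (p ^ k) ∣ n → 3 ≤ p ^ k →
                          m < p ^ k ∸ 1 → m < rem b (p ^ k) → NotSumOfPowers n m b
notSumOfPowers-φDivisor {k = zero} _ _ (s≤s ())
notSumOfPowers-φDivisor {n} {m} {b} {p} {suc j} p-prime φ∣n _ m<N∸1 m<rem =
  notSumOfPowers-% (φDivisor-fermatModulus j p-prime φ∣n) (prime^suc>1 p-prime j)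
                   (≤pred⇒< (<⇒≤ m<N∸1)) (subst (m <_) (rem≡% b N) m<rem)
  where
  N : ℕ
  N = p ^ suc j
  instance
    nonZero-N : NonZero N
    nonZero-N = m^n≢0 p (suc j) {{prime⇒nonZero p-prime}}

notSumOfPowers-2-adic : ∀ {n m b k} .{{_ : NonZero n}} → 2 ^ k ∣ n → 2 ≤ k →
                        m < 2 ^ (k + 2) ∸ 1 → m < rem b (2 ^ (k + 2)) → NotSumOfPowers n m b
notSumOfPowers-2-adic {k = suc zero} _ (s≤s ())
notSumOfPowers-2-adic {n} {m} {b} {suc (suc i)} 2^k∣n _ m<N∸1 m<rem =
  notSumOfPowers-% (subst (FermatModulus n 2) N≡ (twoPower-fermatModulus i 2^k∣n))
                   (^-monoʳ-< 2 ≤-refl (z<s {suc i + 2}))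
                   (≤pred⇒< (<⇒≤ m<N∸1)) (subst (m <_) (rem≡% b N) m<rem)
  where
  N : ℕ
  N = 2 ^ (suc (suc i) + 2)
  instance
    nonZero-N : NonZero N
    nonZero-N = m^n≢0 2 (suc (suc i) + 2)
  N≡ : 2 ^ (4 + i) ≡ N
  N≡ = cong (λ e → 2 ^ (2 + e)) (+-comm 2 i)

notSumOfPowers-halfφDivisor : ∀ {n m b p k} .{{_ : NonZero n}} → Prime p → φ (p ^ k) / 2 ∣ n → 3 ≤ p →
                              m + 1 ≤ rem b (p ^ k) → rem b (p ^ k) ≤ p ^ k ∸ m ∸ 1 → NotSumOfPowers n m b
notSumOfPowers-halfφDivisor {m = m} {b} {k = zero} _ _ _ m+1≤rem _ =
  contradiction (m+n≤o⇒n≤o m (subst (m + 1 ≤_) (n%1≡0 b) m+1≤rem)) λ ()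
notSumOfPowers-halfφDivisor {n} {m} {b} {p} {suc j} p-prime φ/2∣n 3≤p m+1≤rem rem≤N∸m∸1 =
  notSumOfPowers-±1 {n} (oddPrimePower-%≤1∨≡-1 p-prime 3≤p j φ/2∣n)
                    m<r (+<⇐≤∸∸1 (≤-<-trans z≤n m<r) r≤N∸m∸1)
  where
  N : ℕ
  N = p ^ suc j
  instance
    nonZero-N : NonZero N
    nonZero-N = m^n≢0 p (suc j) {{prime⇒nonZero p-prime}}
  m<r : m < b % N
  m<r = subst (m <_) (rem≡% b N) (subst (_≤ rem b N) (+-comm m 1) m+1≤rem)
  r≤N∸m∸1 : b % N ≤ N ∸ m ∸ 1
  r≤N∸m∸1 = subst (_≤ N ∸ m ∸ 1) (rem≡% b N) rem≤N∸m∸1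

fermatModulus-all∣ : ∀ {n q N} .{{_ : NonZero N}} → FermatModulus n q N → 1 < N →
                     ∀ {m} (x : Fin m → ℕ) → m < N →
                     N ∣ sumFin m (λ i → x i ^ n) → ∀ i → q ∣ x i
fermatModulus-all∣ {n} {q} {N} fermat 1<N {m} x m<N N∣sum i =
  fermatModulus-%≡0⇒∣ fermat 1<N (sumFin≡0⇒≡0 m (λ i → x i ^ n % N) R≡0 i)
  where
  R : ℕ
  R = sumFin m (λ i → x i ^ n % N)
  R≤m : R ≤ m
  R≤m = ≤-trans (sumFin-≤ m _ (λ i → fermatModulus-%≤1 fermat 1<N (x i))) (≤-reflexive (*-identityʳ m))
  R≡0 : R ≡ 0
  R≡0 = begin
    R                               ≡⟨ m<n⇒m%n≡m (≤-<-trans R≤m m<N) ⟨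
    R % N                           ≡⟨ sumFin-% m (λ i → x i ^ n) ⟨
    sumFin m (λ i → x i ^ n) % N    ≡⟨ n∣m⇒m%n≡0 _ N N∣sum ⟩
    0                               ∎
    where open ≡-Reasoning

Cancellable : ℕ → ℕ → ℕ → Set
Cancellable n m q = ∀ b c → NotSumOfPowers n m (b * c ^ n) → NotSumOfPowers n m (b * (q * c) ^ n)

fermatModulus-cancellable : ∀ {n q N m} .{{_ : NonZero N}} .{{_ : NonZero q}} →
                            FermatModulus n q N → 1 < N → m < N →
                            Cancellable n m q
fermatModulus-cancellable {n} {q} {N} {m} fermat 1<N m<N b c no-solution x sum≡b[qc]^n = no-solution y sum≡bc^n
  where
  N∣sum : N ∣ sumFin m (λ i → x i ^ n)
  N∣sum = subst (N ∣_) (sym (trans sum≡b[qc]^n (cong (b *_) (^-distribʳ-* q c n))))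
                (∣n⇒∣m*n b (∣m⇒∣m*n (c ^ n) (FermatModulus.modulus∣ fermat)))
  q∣x : ∀ i → q ∣ x i
  q∣x = fermatModulus-all∣ fermat 1<N x m<N N∣sum
  y : Fin m → ℕ
  y i = quotient (q∣x i)
  x^n≡q^n*y^n : ∀ i → x i ^ n ≡ q ^ n * y i ^ n
  x^n≡q^n*y^n i = trans (cong (_^ n) (m∣n⇒n≡m*quotient (q∣x i))) (^-distribʳ-* q (y i) n)
  sum≡bc^n : sumFin m (λ i → y i ^ n) ≡ b * c ^ n
  sum≡bc^n = *-cancelˡ-≡ _ _ (q ^ n) {{m^n≢0 q n}} (begin
    q ^ n * sumFin m (λ i → y i ^ n)   ≡⟨ sumFin-*ˡ m (q ^ n) _ ⟨
    sumFin m (λ i → q ^ n * y i ^ n)   ≡⟨ sumFin-cong m x^n≡q^n*y^n ⟨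
    sumFin m (λ i → x i ^ n)           ≡⟨ sum≡b[qc]^n ⟩
    b * (q * c) ^ n                    ≡⟨ cong (b *_) (^-distribʳ-* q c n) ⟩
    b * (q ^ n * c ^ n)                ≡⟨ *-x∙yz≈y∙xz b (q ^ n) (c ^ n) ⟩
    q ^ n * (b * c ^ n)                ∎)
    where open ≡-Reasoning

module _ {n m : ℕ} where

  cancellable-1 : Cancellable n m 1
  cancellable-1 b c = subst (λ a → NotSumOfPowers n m (b * a ^ n)) (sym (*-identityˡ c))

  cancellable-* : ∀ {q r} → Cancellable n m q → Cancellable n m r → Cancellable n m (q * r)
  cancellable-* {q} {r} q-cancellable r-cancellable b c =
    subst (λ a → NotSumOfPowers n m (b * a ^ n)) (sym (*-assoc q r c)) ∘ q-cancellable b (r * c) ∘ r-cancellable b c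

  cancellable-^ : ∀ {q} → Cancellable n m q → ∀ e → Cancellable n m (q ^ e)
  cancellable-^ _ zero = cancellable-1
  cancellable-^ {q} q-cancellable (suc e) = cancellable-* {q} {q ^ e} q-cancellable (cancellable-^ q-cancellable e)

  cancellable-prodFin : ∀ l (f : Fin l → ℕ) → (∀ i → Cancellable n m (f i)) → Cancellable n m (prodFin l f)
  cancellable-prodFin zero _ _ = cancellable-1
  cancellable-prodFin (suc l) f f-cancellable =
    cancellable-* {f zero} {prodFin l (f ∘ suc)}
      (f-cancellable zero) (cancellable-prodFin l (f ∘ suc) (f-cancellable ∘ suc))

notSumOfPowers-*^ : ∀ {n m b c} → Cancellable n m c → NotSumOfPowers n m b → NotSumOfPowers n m (b * c ^ n)
notSumOfPowers-*^ {n} {m} {b} {c} c-cancellable =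
  subst (λ a → NotSumOfPowers n m (b * a ^ n)) (*-identityʳ c) ∘ c-cancellable b 1 ∘
  subst (NotSumOfPowers n m) (sym (trans (cong (b *_) (^-zeroˡ n)) (*-identityʳ b)))

φDivisor-cancellable : ∀ {n m q k} .{{_ : NonZero n}} → IsφDivisorOfDegree n q k → m ≤ q ^ k ∸ 1 →
                       Cancellable n m q
φDivisor-cancellable {k = zero} (_ , s≤s () , _)
φDivisor-cancellable {q = q} {suc j} (q-prime , _ , φ∣n , _) m≤N∸1 =
  fermatModulus-cancellable (φDivisor-fermatModulus j q-prime φ∣n) (prime^suc>1 q-prime j) (≤pred⇒< m≤N∸1)
  where
  instance
    nonZero-q : NonZero q
    nonZero-q = prime⇒nonZero q-prime
    nonZero-N : NonZero (q ^ suc j)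
    nonZero-N = m^n≢0 q (suc j)

theorem9 : (n : ℕ) → n ≥ 2 → 2 ∣ n →
    (l : ℕ) (ps ks ns : Fin l → ℕ) →
    Injective _≡_ _≡_ ps →
    (∀ i → IsφDivisorOfDegree n (ps i) (ks i)) →
    (m : ℕ) → 2 ≤ m → (∀ i → m ≤ ps i ^ ks i ∸ 1) →
    (∀ i → ns i ≥ 1) →
    (b : ℕ) (p k : ℕ) → Prime p →
    let c = prodFin l (λ i → ps i ^ ns i) in
    ( (m < 2 ^ n ∸ 1 × m + 1 ≤ b × b ≤ 2 ^ n ∸ 1)
    ⊎ (φ (p ^ k) ∣ n × p ^ k ≥ 3 × m < p ^ k ∸ 1 × rem b (p ^ k) > m)
    ⊎ (2 ^ k ∣ n × k ≥ 2 × m < 2 ^ (k + 2) ∸ 1 × rem b (2 ^ (k + 2)) > m)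
    ⊎ (φ (p ^ k) / 2 ∣ n × p ≥ 3 × m < (p ^ k ∸ 1) / 2 ×
         m + 1 ≤ rem b (p ^ k) × rem b (p ^ k) ≤ p ^ k ∸ m ∸ 1) ) →
    (x : Fin m → ℕ) → sumFin m (λ i → x i ^ n) ≢ b * c ^ n
-- Evenness of n, distinctness of the p_i, 2 ≤ m, n_i ≥ 1, maximality of the degrees and
-- the bound m < (p^k − 1)/2 in case 4 are not needed.
theorem9 n n≥2 _ l ps ks ns _ ps-φDivisors m _ m≤ps^ks∸1 _ b p k p-prime cases =
  notSumOfPowers-*^ {n} {m} {b} c-cancellable ([ case₁ , [ case₂ , [ case₃ , case₄ ]′ ]′ ]′ cases)
  where
  instance
    nonZero-n : NonZero n
    nonZero-n = >-nonZero (≤-trans z<s n≥2)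
  c-cancellable : Cancellable n m (prodFin l (λ i → ps i ^ ns i))
  c-cancellable = cancellable-prodFin {n} {m} l (λ i → ps i ^ ns i) λ i →
    cancellable-^ {n} {m} {ps i} (φDivisor-cancellable {n} {m} (ps-φDivisors i) (m≤ps^ks∸1 i)) (ns i)
  case₁ : m < 2 ^ n ∸ 1 × m + 1 ≤ b × b ≤ 2 ^ n ∸ 1 → NotSumOfPowers n m b
  case₁ = λ (_ , m+1≤b , b≤2^n∸1) →
    notSumOfPowers-small {n} (subst (_≤ b) (+-comm m 1) m+1≤b) (≤pred⇒< {{m^n≢0 2 n}} b≤2^n∸1)
  case₂ : φ (p ^ k) ∣ n × p ^ k ≥ 3 × m < p ^ k ∸ 1 × rem b (p ^ k) > m → NotSumOfPowers n m b
  case₂ = λ (φ∣n , 3≤p^k , m<p^k∸1 , m<rem) →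
    notSumOfPowers-φDivisor {k = k} p-prime φ∣n 3≤p^k m<p^k∸1 m<rem
  case₃ : 2 ^ k ∣ n × k ≥ 2 × m < 2 ^ (k + 2) ∸ 1 × rem b (2 ^ (k + 2)) > m → NotSumOfPowers n m b
  case₃ = λ (2^k∣n , 2≤k , m<2^[k+2]∸1 , m<rem) →
    notSumOfPowers-2-adic {b = b} {k} 2^k∣n 2≤k m<2^[k+2]∸1 m<rem
  case₄ : φ (p ^ k) / 2 ∣ n × p ≥ 3 × m < (p ^ k ∸ 1) / 2 ×
          m + 1 ≤ rem b (p ^ k) × rem b (p ^ k) ≤ p ^ k ∸ m ∸ 1 → NotSumOfPowers n m b
  case₄ = λ (φ/2∣n , 3≤p , _ , m+1≤rem , rem≤p^k∸m∸1) →
    notSumOfPowers-halfφDivisor {k = k} p-prime φ/2∣n 3≤p m+1≤rem rem≤p^k∸m∸1
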